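{- Let $\mathbf{P}=(p_1,\dots,p_m)$ be a finite vector of distinct primes. For each integer $n\ge 2$ let $a_n=1$ if the tower expansion of $n$ is a tower over $\mathbf{P}$ (i.e. every prime occurring anywhere, at any level, in the tower expansion of $n$ belongs to $\{p_1,\dots,p_m\}$), and $a_n=0$ otherwise. Then $$1+\sum_{n\ge 2} \frac{a_n}{n}<\infty .$$
   Context: Every integer $n>1$ has a unique tower expansion over the primes: $n=\prod_{i} q_i^{E_i}$ with distinct primes $q_i$ (in increasing order), where each exponent $E_i$ is either omitted (exponent $1$) or is recursively the tower expansion of an integer $e_i>1$. For instance $16=2^{2^{2}}$ and $2^{6}=2^{2\cdot 3}$. The primes occurring in the tower expansion of $n$ are all primes appearing at any level of this nested expression. (In the paper, the integers with $a_n=1$ are those whose towers appear in the formal limit $\lim_{k\to\infty}G_k(\mathbf{P})=1+\sum_{n\ge2}a_n T_{\mathbf{P}}(n)$, where $G_0(\mathbf{P})=\prod_k(1+g(p_k))$, $g(x)=1+x+x^x+x^{x^x}+\cdots$, and $G_{k+1}(\mathbf{P})=\prod_k\bigl(1+\sum_{T} p_k^{T}\bigr)$ with $T$ running over the towers in $G_k(\mathbf{P})$.) -}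

module Defs where

open import Data.Nat using (ℕ; zero; suc; _≤_; _^_)
open import Data.Nat.Divisibility using (_∣_)
open import Data.Nat.Primality using (Prime)
open import Data.Integer using (+_)
open import Data.Rational using (ℚ; _/_; 0ℚ; _+_)
open import Data.List using (List; foldr; map)
open import Data.List.Membership.Propositional using (_∈_)
open import Data.Product using (_×_)
open import Data.Sum using (_⊎_)
open import Relation.Binary.PropositionalEquality using (_≡_)
open import Relation.Nullary using (¬_)

-- TowerOver P n : the tower expansion of n (n ≥ 2) only involves primes from P.
-- Recursively: n ≥ 2 and for every prime q dividing n, with exact exponent e
-- (q ^ e ∣ n, ¬ q ^ (e+1) ∣ n), we have q ∈ P and either e = 1 or the tower
-- expansion of e is again over P.
data TowerOver (P : List ℕ) : ℕ → Set where
  tower : ∀ {n} → 2 ≤ n →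
          (∀ q e → Prime q → q ∣ n → q ^ e ∣ n → ¬ (q ^ suc e ∣ n) →
             (q ∈ P) × (e ≡ 1 ⊎ TowerOver P e)) →
          TowerOver P n

-- reciprocal 1/n as a rational (with the junk value 1/0 := 0)
recip : ℕ → ℚ
recip zero = 0ℚ
recip (suc k) = (+ 1) / suc k

sumℚ : List ℚ → ℚ
sumℚ = foldr _+_ 0ℚ

module Submission where

-- If n is a tower over P then, at the lowest level, every prime divisor of n
-- lies in P: n is P-smooth.  So it suffices to bound the reciprocal sums of
-- finite sets of P-smooth numbers, which we do for any list P of integers
-- ≥ 2 by the crude Euler-product bound  Σ_{n ∈ S} 1/n ≤ 2 ^ |P|.
-- Induction on P.  For P = [] only n = 1 is smooth.  For p ∷ P, split S into
-- S₀ (not divisible by p), which is P-smooth, and S₁ (divisible by p).  The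
-- map n ↦ n / p sends S₁ injectively to a (p ∷ P)-smooth set with smaller
-- elements, and 1/n ≤ ½ · 1/(n/p) because p ≥ 2; an inner induction on the
-- size of the elements then gives 2 Σ_{S₁} ≤ 2 · 2^|P|.

open import Defs
open import Data.Nat using (ℕ)
open import Data.Nat.Primality using (Prime)
open import Data.Rational using (ℚ; _≤_)
open import Data.List using (List; map)
open import Data.List.Relation.Unary.All using (All)
open import Data.List.Relation.Unary.Unique.Propositional using (Unique)
open import Data.Product using (∃)

open import Data.Nat as ℕ using (zero; suc; z≤n; s≤s; _^_; NonZero; >-nonZero)
import Data.Nat.Properties as ℕₚ
open import Data.Nat.ListAction using (sum)
open import Data.Nat.Tactic.RingSolver using (solve-∀)
open import Data.Nat.Divisibility as ∣ using (_∣_; _∣?_; divides-refl)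
open import Data.Nat.DivMod using (_/_; m/n*n≡m; m*[n/m]≡n; m/n<m; m≥n⇒m/n>0)
open import Data.Nat.Primality using (prime)
open import Data.Nat.Primality.Factorisation using (factorise)
open import Data.Nat.Induction using (<-wellFounded)
open import Induction.WellFounded using (Acc; acc)
open import Data.Integer as ℤ using (+≤+)
open import Data.Rational using (1ℚ; _+_; toℚᵘ)
import Data.Rational.Properties as ℚₚ
open import Data.Rational.Unnormalised as ℚᵘ using (mkℚᵘ; *≤*)
import Data.Rational.Unnormalised.Properties as ℚᵘₚ
open import Algebra.Bundles using (CommutativeMonoid)
open import Algebra.Properties.CommutativeSemigroup
  (CommutativeMonoid.commutativeSemigroup ℚₚ.+-0-commutativeMonoid)
  using (interchange; x∙yz≈y∙xz)
open import Data.List using ([]; _∷_; filter; length)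
import Data.List.Properties as Listₚ
open import Data.List.Relation.Unary.All as All using ([]; _∷_)
import Data.List.Relation.Unary.All.Properties as Allₚ
import Data.List.Relation.Unary.Unique.Propositional.Properties as Uniqueₚ
open import Data.List.Relation.Unary.AllPairs using ([]; _∷_)
open import Data.List.Membership.Propositional using (_∈_)
open import Data.List.Relation.Unary.Any using (here; there)
open import Data.Product using (_,_; _×_; proj₁)
open import Function using (_∘_)
open import Relation.Nullary using (¬_; yes; no; ¬?; contradiction)
open import Relation.Unary using (Pred; Decidable)
open import Relation.Binary.PropositionalEquality

recipSum : List ℕ → ℚ
recipSum S = sumℚ (map recip S)

-- The arithmetic core of the halving step, in the shape produced by adding
-- unnormalised fractions: (a + a) b ≤ a a when 2 b ≤ a.
double-times-≤ : ∀ a b → 2 ℕ.* b ℕ.≤ a → (1 ℕ.* a ℕ.+ 1 ℕ.* a) ℕ.* b ℕ.≤ 1 ℕ.* (a ℕ.* a)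
double-times-≤ a b 2b≤a = begin
  (1 ℕ.* a ℕ.+ 1 ℕ.* a) ℕ.* b  ≡⟨ regroup a b ⟩
  a ℕ.* (2 ℕ.* b)              ≤⟨ ℕₚ.*-monoʳ-≤ a 2b≤a ⟩
  a ℕ.* a                      ≡⟨ ℕₚ.*-identityˡ (a ℕ.* a) ⟨
  1 ℕ.* (a ℕ.* a)              ∎
  where
  open ℕₚ.≤-Reasoning
  regroup : ∀ a b → (1 ℕ.* a ℕ.+ 1 ℕ.* a) ℕ.* b ≡ a ℕ.* (2 ℕ.* b)
  regroup = solve-∀

-- 1/a + 1/a ≤ 1/b whenever a ≥ 2b ≥ 2: the only estimate on individual terms.
-- Checked on unnormalised fractions, where it is a single integer inequality.
recip-halves : ∀ {a b} → 1 ℕ.≤ b → 2 ℕ.* b ℕ.≤ a → recip a + recip a ≤ recip b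
recip-halves {suc i} {b@(suc j)} _ 2b≤a = ℚₚ.toℚᵘ-cancel-≤ (begin
  toℚᵘ (recip a + recip a)            ≃⟨ ℚₚ.toℚᵘ-homo-+ (recip a) (recip a) ⟩
  toℚᵘ (recip a) ℚᵘ.+ toℚᵘ (recip a)  ≃⟨ ℚᵘₚ.+-cong 1/a≃ 1/a≃ ⟩
  1/aᵘ ℚᵘ.+ 1/aᵘ                      ≤⟨ *≤* (+≤+ (double-times-≤ a b 2b≤a)) ⟩
  mkℚᵘ (ℤ.+ 1) j                      ≃⟨ ℚₚ.toℚᵘ-fromℚᵘ (mkℚᵘ (ℤ.+ 1) j) ⟨
  toℚᵘ (recip b)                      ∎)
  where
  open ℚᵘₚ.≤-Reasoning
  a = suc i
  1/aᵘ : ℚᵘ.ℚᵘ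
  1/aᵘ = mkℚᵘ (ℤ.+ 1) i
  1/a≃ : toℚᵘ (recip a) ℚᵘ.≃ 1/aᵘ
  1/a≃ = ℚₚ.toℚᵘ-fromℚᵘ 1/aᵘ

halve-≤ : ∀ {x y} → x + x ≤ y + y → x ≤ y
halve-≤ 2x≤2y = ℚₚ.≮⇒≥ λ y<x →
  ℚₚ.<-irrefl refl (ℚₚ.<-≤-trans (ℚₚ.+-mono-< y<x y<x) 2x≤2y)

recipSum-partition : ∀ {ℓ} {Q : Pred ℕ ℓ} (Q? : Decidable Q) S →
  recipSum S ≡ recipSum (filter (¬? ∘ Q?) S) + recipSum (filter Q? S)
recipSum-partition Q? [] = refl
recipSum-partition Q? (x ∷ S) with Q? x
... | yes _ = begin
  recip x + recipSum S      ≡⟨ cong (recip x +_) (recipSum-partition Q? S) ⟩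
  recip x + (S₀ + S₁)       ≡⟨ x∙yz≈y∙xz (recip x) S₀ S₁ ⟩
  S₀ + (recip x + S₁)       ∎
  where
  open ≡-Reasoning
  S₀ = recipSum (filter (¬? ∘ Q?) S)
  S₁ = recipSum (filter Q? S)
... | no _ = begin
  recip x + recipSum S      ≡⟨ cong (recip x +_) (recipSum-partition Q? S) ⟩
  recip x + (S₀ + S₁)       ≡⟨ ℚₚ.+-assoc (recip x) S₀ S₁ ⟨
  (recip x + S₀) + S₁       ∎
  where
  open ≡-Reasoning
  S₀ = recipSum (filter (¬? ∘ Q?) S)
  S₁ = recipSum (filter Q? S)

Smooth : List ℕ → ℕ → Set
Smooth P n = 1 ℕ.≤ n × (∀ q → Prime q → q ∣ n → q ∈ P)

-- 2 ^ m as a rational, unfolded so that 2^(m+1) is literally 2^m + 2^m.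
twoPow : ℕ → ℚ
twoPow zero = 1ℚ
twoPow (suc m) = twoPow m + twoPow m

smooth-[] : ∀ {n} → Smooth [] n → n ≡ 1
smooth-[] {suc zero} _ = refl
smooth-[] {suc (suc k)} (_ , primes∈[]) with factorise (suc (suc k))
... | record { factors = q ∷ _ ; isFactorisation = n≡product ; factorsPrime = q-prime ∷ _ }
  with () ← primes∈[] q q-prime (subst (q ∣_) (sym n≡product) (∣.m∣m*n _))

-- Base case of the bound: a duplicate-free list of []-smooth numbers is [] or [ 1 ].
recipSum-smooth-[] : ∀ {S} → Unique S → All (Smooth []) S → recipSum S ≤ twoPow 0
recipSum-smooth-[] {[]} _ _ = ℚₚ.nonNegative⁻¹ 1ℚ
recipSum-smooth-[] {x ∷ []} _ (x-smooth ∷ []) rewrite smooth-[] x-smooth = ℚₚ.≤-refl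
recipSum-smooth-[] {x ∷ y ∷ _} ((x≢y ∷ _) ∷ _) (x-smooth ∷ y-smooth ∷ _) =
  contradiction (trans (smooth-[] x-smooth) (sym (smooth-[] y-smooth))) x≢y

module DivideOut (p : ℕ) (p≥2 : 2 ℕ.≤ p) where

  instance
    p≢0 : NonZero p
    p≢0 = >-nonZero (ℕₚ.≤-trans (s≤s z≤n) p≥2)

  quotient-pos : ∀ {n} → 1 ℕ.≤ n → p ∣ n → 1 ℕ.≤ n / p
  quotient-pos n≥1 p∣n = m≥n⇒m/n>0 (∣.∣⇒≤ ⦃ >-nonZero n≥1 ⦄ p∣n)

  quotient-halves : ∀ {n} → p ∣ n → 2 ℕ.* (n / p) ℕ.≤ n
  quotient-halves {n} p∣n =
    ℕₚ.≤-trans (ℕₚ.*-monoˡ-≤ (n / p) p≥2) (ℕₚ.≤-reflexive (m*[n/m]≡n p∣n))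

  quotient-< : ∀ {n} → 1 ℕ.≤ n → n / p ℕ.< n
  quotient-< {n} n≥1 = m/n<m n p ⦃ >-nonZero n≥1 ⦄ p≥2

  All-quotients : ∀ {ℓ ℓ′} {A : Pred ℕ ℓ} {B : Pred ℕ ℓ′} →
    (∀ {n} → p ∣ n → A n → B (n / p)) →
    ∀ {L} → All (p ∣_) L → All A L → All B (map (_/ p) L)
  All-quotients f p∣L A-L = Allₚ.map⁺ (All.zipWith (λ (p∣n , An) → f p∣n An) (p∣L , A-L))

  quotients-unique : ∀ {L} → All (p ∣_) L → Unique L → Unique (map (_/ p) L)
  quotients-unique {L} p∣L unique = Uniqueₚ.map⁻ {f = ℕ._* p} (subst Unique L≡ unique)
    where
    L≡ : L ≡ map (ℕ._* p) (map (_/ p) L)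
    L≡ = trans (sym (Listₚ.map-id-local (All.map m/n*n≡m p∣L))) (Listₚ.map-∘ L)

  recipSum-quotients : ∀ {L} → All (p ∣_) L → All (1 ℕ.≤_) L →
    recipSum L + recipSum L ≤ recipSum (map (_/ p) L)
  recipSum-quotients [] [] = ℚₚ.≤-refl
  recipSum-quotients {x ∷ L} (p∣x ∷ p∣L) (x≥1 ∷ L≥1) = begin
    (recip x + recipSum L) + (recip x + recipSum L)
      ≡⟨ interchange (recip x) (recipSum L) (recip x) (recipSum L) ⟩
    (recip x + recip x) + (recipSum L + recipSum L)
      ≤⟨ ℚₚ.+-mono-≤ x-halves (recipSum-quotients p∣L L≥1) ⟩
    recip (x / p) + recipSum (map (_/ p) L)
      ∎
    where
    open ℚₚ.≤-Reasoning
    x-halves : recip x + recip x ≤ recip (x / p)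
    x-halves = recip-halves (quotient-pos x≥1 p∣x) (quotient-halves p∣x)

  smooth-quotient : ∀ {P n} → p ∣ n → Smooth P n → Smooth P (n / p)
  smooth-quotient p∣n (n≥1 , primes∈P) =
    quotient-pos n≥1 p∣n ,
    λ q q-prime q∣n/p → primes∈P q q-prime (∣.∣-trans q∣n/p (∣.m/n∣m p∣n))

  smooth-coprime : ∀ {P n} → ¬ p ∣ n → Smooth (p ∷ P) n → Smooth P n
  smooth-coprime {P} {n} p∤n (n≥1 , primes∈pP) =
    n≥1 , λ q q-prime q∣n → drop-p q∣n (primes∈pP q q-prime q∣n)
    where
    drop-p : ∀ {q} → q ∣ n → q ∈ p ∷ P → q ∈ P
    drop-p q∣n (here refl) = contradiction q∣n p∤n
    drop-p _ (there q∈P) = q∈P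

  -- Induction on k: the multiples of p are traded for their
  -- quotients, which are smaller, and whose sum is at least twice as large.
  module _ {P : List ℕ} {B : ℚ}
           (bound-P : ∀ {S} → Unique S → All (Smooth P) S → recipSum S ≤ B) where

    bound-below : ∀ k {S} → All (ℕ._< k) S → Unique S → All (Smooth (p ∷ P)) S →
      recipSum S ≤ B + B
    bound-below zero {[]} _ _ _ = ℚₚ.+-mono-≤ (bound-P [] []) (bound-P [] [])
    bound-below zero {_ ∷ _} (() ∷ _) _ _
    bound-below (suc k) {S} S<k+1 unique smooth = begin
      recipSum S                 ≡⟨ recipSum-partition (p ∣?_) S ⟩
      recipSum S₀ + recipSum S₁  ≤⟨ ℚₚ.+-mono-≤ S₀-bound (halve-≤ S₁-doubled) ⟩
      B + B                      ∎
      where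
      open ℚₚ.≤-Reasoning
      S₀ = filter (¬? ∘ (p ∣?_)) S
      S₁ = filter (p ∣?_) S

      smooth₀ : All (Smooth P) S₀
      smooth₀ = All.zipWith (λ (p∤n , n-smooth) → smooth-coprime p∤n n-smooth)
        (Allₚ.all-filter (¬? ∘ (p ∣?_)) S , Allₚ.filter⁺ (¬? ∘ (p ∣?_)) smooth)

      S₀-bound : recipSum S₀ ≤ B
      S₀-bound = bound-P (Uniqueₚ.filter⁺ (¬? ∘ (p ∣?_)) unique) smooth₀

      p∣S₁ : All (p ∣_) S₁
      p∣S₁ = Allₚ.all-filter (p ∣?_) S

      smooth₁ : All (Smooth (p ∷ P)) S₁
      smooth₁ = Allₚ.filter⁺ (p ∣?_) smooth

      quotients-below : All (ℕ._< k) (map (_/ p) S₁)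
      quotients-below = All-quotients
        (λ _ ((n≥1 , _) , n<k+1) → ℕₚ.<-≤-trans (quotient-< n≥1) (ℕ.s≤s⁻¹ n<k+1))
        p∣S₁ (All.zip (smooth₁ , Allₚ.filter⁺ (p ∣?_) S<k+1))

      S₁-doubled : recipSum S₁ + recipSum S₁ ≤ B + B
      S₁-doubled = ℚₚ.≤-trans (recipSum-quotients p∣S₁ (All.map proj₁ smooth₁))
        (bound-below k quotients-below
          (quotients-unique p∣S₁ (Uniqueₚ.filter⁺ (p ∣?_) unique))
          (All-quotients smooth-quotient p∣S₁ smooth₁))

below-sum : ∀ S → All (ℕ._< suc (sum S)) S
below-sum [] = []
below-sum (x ∷ S) = s≤s (ℕₚ.m≤m+n x (sum S))
  ∷ All.map (λ y<S → ℕₚ.≤-trans y<S (s≤s (ℕₚ.m≤n+m (sum S) x))) (below-sum S)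

recipSum-smooth : ∀ {P} → All (2 ℕ.≤_) P → ∀ {S} → Unique S → All (Smooth P) S →
  recipSum S ≤ twoPow (length P)
recipSum-smooth [] = recipSum-smooth-[]
recipSum-smooth {p ∷ P} (p≥2 ∷ P≥2) {S} =
  DivideOut.bound-below p p≥2 (recipSum-smooth P≥2) (suc (sum S)) (below-sum S)

exact-power-* : ∀ {q m e} .⦃ _ : NonZero q ⦄ → q ^ e ∣ m → ¬ (q ^ suc e ∣ m) →
  (q ^ suc e ∣ m ℕ.* q) × ¬ (q ^ suc (suc e) ∣ m ℕ.* q)
exact-power-* {q} {m} {e} qᵉ∣m qᵉ⁺¹∤m =
  reorder {q ^ e} (∣.*-monoˡ-∣ q qᵉ∣m) ,
  λ qᵉ⁺²∣mq → qᵉ⁺¹∤m (∣.*-cancelʳ-∣ q (reorder {q} qᵉ⁺²∣mq))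
  where
  -- q ^ suc d is q * q ^ d; the divisibility lemmas want q on the right
  reorder : ∀ {a b} → a ℕ.* b ∣ m ℕ.* q → b ℕ.* a ∣ m ℕ.* q
  reorder {a} {b} = subst (_∣ m ℕ.* q) (ℕₚ.*-comm a b)

exact-power : ∀ {q} → 2 ℕ.≤ q → ∀ {n} .⦃ _ : NonZero n ⦄ → Acc ℕ._<_ n →
  ∃ λ e → (q ^ e ∣ n) × ¬ (q ^ suc e ∣ n)
exact-power {q} q≥2 {n} (acc smaller) with q ∣? n
... | no q∤n = 0 , ∣.1∣ n , λ q¹∣n → q∤n (subst (_∣ n) (ℕₚ.*-identityʳ q) q¹∣n)
... | yes (divides-refl m) = raise (exact-power q≥2 (smaller (ℕₚ.m<m*n m q q≥2)))
  where
  instance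
    m≢0 : NonZero m
    m≢0 = ℕₚ.m*n≢0⇒m≢0 m
    q≢0 : NonZero q
    q≢0 = >-nonZero (ℕₚ.≤-trans (s≤s z≤n) q≥2)
  raise : (∃ λ e → (q ^ e ∣ m) × ¬ (q ^ suc e ∣ m)) →
          ∃ λ e → (q ^ e ∣ m ℕ.* q) × ¬ (q ^ suc e ∣ m ℕ.* q)
  raise (e , qᵉ∣m , qᵉ⁺¹∤m) = suc e , exact-power-* {e = e} qᵉ∣m qᵉ⁺¹∤m

prime≥2 : ∀ {q} → Prime q → 2 ℕ.≤ q
prime≥2 {q} (prime _) = ℕ.nonTrivial⇒n>1 q

-- A tower over P is P-smooth: each prime divisor q of n occurs with some
-- exact exponent e, and the tower condition for (q, e) puts q in P.
tower⇒smooth : ∀ {P n} → TowerOver P n → Smooth P n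
tower⇒smooth {P} {n} (tower n≥2 bottom-level) = n≥1 , primes∈P
  where
  n≥1 : 1 ℕ.≤ n
  n≥1 = ℕₚ.≤-trans (s≤s z≤n) n≥2
  primes∈P : ∀ q → Prime q → q ∣ n → q ∈ P
  primes∈P q q-prime q∣n with exact-power (prime≥2 q-prime) ⦃ >-nonZero n≥1 ⦄ (<-wellFounded n)
  ... | e , qᵉ∣n , qᵉ⁺¹∤n = proj₁ (bottom-level q e q-prime q∣n qᵉ∣n qᵉ⁺¹∤n)

mainTheorem2 : (P : List ℕ) → All Prime P → Unique P →
    ∃ λ (B : ℚ) → (S : List ℕ) → Unique S → All (TowerOver P) S →
      sumℚ (map recip S) ≤ B
mainTheorem2 P P-prime _ = twoPow (length P) , λ S S-unique S-towers →
  recipSum-smooth (All.map prime≥2 P-prime) S-unique (All.map tower⇒smooth S-towers)
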